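{- Let $1\le i\le\ell-1$, let $M\subseteq U_i$, and let $S_j,S_k\in\mathcal{S}$ be such that $(V,S_j)[M]$ is disconnected, $(V,S_k)[M]$ is connected, and $|S_j\cap\delta(U_i\setminus M)|\le 1$. Then there exist edges $e\in S_j$ and $f\in S_k$ such that $(S_j\setminus\{e\})\cup\{f\}\in\mathcal{S}$, $(S_k\setminus\{f\})\cup\{e\}\in\mathcal{S}$, $e\notin E[U_i]$ and $f\in E[M]$.
   Context: $V$ is a finite set, $s,t\in V$ with $s\neq t$, and $E$ is the edge set of the complete graph on $V$. For $U\subseteq V$, $\delta(U)$ is the set of edges with exactly one endpoint in $U$, $\delta(v):=\delta(\{v\})$, and $E[U]$ is the set of edges with both endpoints in $U$. For $F\subseteq E$ and $U\subseteq V$, $(V,F)[U]$ denotes the graph $(U,F\cap E[U])$. $\mathcal{S}$ is the set of edge sets of spanning trees of $(V,E)$. $x^*$ is a fixed optimal solution of the LP: minimize $\sum_e c_ex_e$ (for a given metric $c$ on $V$) subject to $x(\delta(U))\ge 2$ for all $\emptyset\ne U\subsetneq V$ with $|U\cap\{s,t\}|$ even, $x(\delta(U))\ge 1$ for all $\emptyset\ne U\subsetneq V$ with $|U\cap\{s,t\}|$ odd, $x(\delta(v))=2$ for $v\in V\setminus\{s,t\}$, $x(\delta(v))=1$ for $v\in\{s,t\}$, $x\ge 0$, where $x(F):=\sum_{e\in F}x_e$. A narrow cut is a cut $C=\delta(U)$ with $x^*(C)<2$. It is known that the narrow cuts form a chain: there are sets $\{s\}=U_0\subset U_1\subset\cdots\subset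 U_\ell=V\setminus\{t\}$ such that the narrow cuts are exactly $\delta(U_i)$, $i=0,\ldots,\ell$. -}

module Defs where

open import Data.Nat using (ℕ; _≤_)
open import Data.Fin using (Fin; _≟_)
open import Data.Fin.Subset using (Subset; _∈_; _∉_; ⊤)
open import Data.Bool using (Bool; true; false; if_then_else_; _∧_; _∨_)
open import Data.List using (List; []; _∷_; length; _∷ʳ_)
open import Data.List.Relation.Unary.Linked using (Linked)
open import Data.List.Relation.Unary.Unique.Propositional using (Unique)
open import Data.Product using (Σ; _×_)
open import Relation.Nullary using (¬_)
open import Relation.Nullary.Decidable using (⌊_⌋)
open import Relation.Binary.PropositionalEquality using (_≡_)

-- Vertex set V = Fin n.  An edge set of the complete graph on V is
-- represented by its (Boolean) adjacency function; the edge {u,v}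
-- (u ≢ v) belongs to F iff F u v ≡ true.
EdgeSet : ℕ → Set
EdgeSet n = Fin n → Fin n → Bool

IsEdgeSet : {n : ℕ} → EdgeSet n → Set
IsEdgeSet {n} F = ((u v : Fin n) → F u v ≡ F v u) × ((u : Fin n) → F u u ≡ false)

Adj : {n : ℕ} → EdgeSet n → Fin n → Fin n → Set
Adj F u v = F u v ≡ true

data Walk {n : ℕ} (F : EdgeSet n) (M : Subset n) : Fin n → Fin n → Set where
  stay : {u : Fin n} → u ∈ M → Walk F M u u
  step : {u v w : Fin n} → u ∈ M → Adj F u v → Walk F M v w → Walk F M u w

ConnectedOn : {n : ℕ} → EdgeSet n → Subset n → Set
ConnectedOn {n} F M = (u v : Fin n) → u ∈ M → v ∈ M → Walk F M u v

Cycle : {n : ℕ} → EdgeSet n → Set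
Cycle {n} F = Σ (Fin n) λ v → Σ (List (Fin n)) λ ws →
  (2 ≤ length ws) × Unique (v ∷ ws) × Linked (Adj F) ((v ∷ ws) ∷ʳ v)

Acyclic : {n : ℕ} → EdgeSet n → Set
Acyclic F = ¬ Cycle F

IsSpanningTree : {n : ℕ} → EdgeSet n → Set
IsSpanningTree {n} F = IsEdgeSet F × ConnectedOn F ⊤ × Acyclic F

sameEdge : {n : ℕ} → Fin n → Fin n → Fin n → Fin n → Bool
sameEdge x y c d = (⌊ x ≟ c ⌋ ∧ ⌊ y ≟ d ⌋) ∨ (⌊ x ≟ d ⌋ ∧ ⌊ y ≟ c ⌋)

exchange : {n : ℕ} → EdgeSet n → Fin n → Fin n → Fin n → Fin n → EdgeSet n
exchange F a b c d x y =
  if sameEdge x y c d then true else (if sameEdge x y a b then false else F x y)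

-- |F ∩ δ(W)| ≤ 1 : any two edges of F with exactly one endpoint in W
-- coincide (each written with its endpoint in W first)
AtMostOneCrossing : {n : ℕ} → EdgeSet n → (Fin n → Set) → Set
AtMostOneCrossing {n} F W = (a b c d : Fin n) →
  Adj F a b → W a → ¬ W b → Adj F c d → W c → ¬ W d → (a ≡ c × b ≡ d)

InDiff : {n : ℕ} → Subset n → Subset n → Fin n → Set
InDiff U M v = v ∈ U × v ∉ M

-- As (V,Sj)[M] is disconnected, the Sj-path between some two vertices of M leaves M.  Since Sj
-- has at most one edge leaving U ∖ M and a path in a tree never recrosses an edge, once the path
-- steps out of M it cannot enter U ∖ M, so it runs outside U until it re-enters M.  This gives an
-- Sj-path P from u ∈ M to v ∈ M with no edge in E[U]; let Q be the Sk-path from u to v inside M.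
-- Walking along P and Q simultaneously one finds an edge e of P and an edge f of Q such that f
-- reconnects the two components of Sj − e and e those of Sk − f, so both exchanges are trees.
module Submission where

open import Defs
open import Data.Nat using (ℕ; s≤s; z≤n)
open import Data.Fin using (Fin; _≟_)
open import Data.Fin.Subset using (Subset; _∈_; _∉_; _⊆_; ⊤)
open import Data.Fin.Subset.Properties using (_∈?_; ∈⊤)
open import Data.Bool using (true; false; if_then_else_)
open import Data.Bool.Properties using (⇔→≡; ¬-not)
open import Data.Empty using (⊥; ⊥-elim)
open import Data.Unit using (tt) renaming (⊤ to Unit)
open import Data.Product using (Σ; ∃; _×_; _,_; proj₁; proj₂)
import Data.Product as Product
open import Data.Sum using (_⊎_; inj₁; inj₂)
import Data.Sum as Sum
open import Data.List using (List; []; _∷_; _∷ʳ_)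
open import Data.List.Relation.Unary.All using (All; []; _∷_)
import Data.List.Relation.Unary.All as All
open import Data.List.Relation.Unary.All.Properties using (¬Any⇒All¬)
open import Data.List.Relation.Unary.Any using (Any; here; there; any?)
open import Data.List.Relation.Unary.AllPairs using ([]; _∷_)
open import Data.List.Relation.Unary.Linked using (Linked; [-]; _∷_)
import Data.List.Relation.Unary.Linked as Linked
open import Data.List.Relation.Unary.Unique.Propositional using (Unique)
open import Function using (_∘_; id)
open import Function.Bundles using (mk⇔)
open import Level using (0ℓ)
open import Relation.Binary using (Rel; _⇒_; DecidableEquality)
open import Relation.Binary.Construct.Closure.ReflexiveTransitive
  using (Star; ε; _◅_; _◅◅_; reverse)
import Relation.Binary.Construct.Closure.ReflexiveTransitive as Star
open import Relation.Nullary using (¬_; Dec; yes; no; _because_)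
open import Relation.Nullary.Decidable using (⌊_⌋; _×-dec_; ¬?; decidable-stable)
import Relation.Unary as U
import Data.Fin.Properties as Fin
open import Relation.Nullary.Reflects using (Reflects; ofʸ; ofⁿ; _×-reflects_; _⊎-reflects_)
open import Relation.Binary.PropositionalEquality using (_≡_; _≢_; refl; sym; trans; subst)

private variable
  n : ℕ
  F : EdgeSet n
  a b c d u v w x y z : Fin n

SameEdge : Fin n → Fin n → Fin n → Fin n → Set
SameEdge x y c d = (x ≡ c × y ≡ d) ⊎ (x ≡ d × y ≡ c)

SameEdge-sym : SameEdge x y c d → SameEdge y x c d
SameEdge-sym (inj₁ (p , q)) = inj₂ (q , p)
SameEdge-sym (inj₂ (p , q)) = inj₁ (q , p)

SameEdge-swap : SameEdge x y c d → SameEdge x y d c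
SameEdge-swap (inj₁ pq) = inj₂ pq
SameEdge-swap (inj₂ pq) = inj₁ pq

SameEdge-comm : SameEdge x y c d → SameEdge c d x y
SameEdge-comm (inj₁ (refl , refl)) = inj₁ (refl , refl)
SameEdge-comm (inj₂ (refl , refl)) = inj₂ (refl , refl)

SameEdge-trans : SameEdge x y a b → SameEdge a b c d → SameEdge x y c d
SameEdge-trans (inj₁ (refl , refl)) s = s
SameEdge-trans (inj₂ (refl , refl)) s = SameEdge-sym s

isYes-reflects : {A : Set} (A? : Dec A) → Reflects A ⌊ A? ⌋
isYes-reflects (yes a) = ofʸ a
isYes-reflects (no ¬a) = ofⁿ ¬a

sameEdge-reflects : (x y c d : Fin n) → Reflects (SameEdge x y c d) (sameEdge x y c d)
sameEdge-reflects x y c d =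
  (isYes-reflects (x ≟ c) ×-reflects isYes-reflects (y ≟ d)) ⊎-reflects
  (isYes-reflects (x ≟ d) ×-reflects isYes-reflects (y ≟ c))

sameEdge? : (x y c d : Fin n) → Dec (SameEdge x y c d)
sameEdge? x y c d = sameEdge x y c d because sameEdge-reflects x y c d

module _ {A : Set} where

  if-false⁻ : ∀ {β b} → Reflects A β → (if β then false else b) ≡ true → b ≡ true × ¬ A
  if-false⁻ (ofʸ _)  ()
  if-false⁻ (ofⁿ ¬a) h = h , ¬a

  if-false⁺ : ∀ {β b} → Reflects A β → b ≡ true → ¬ A → (if β then false else b) ≡ true
  if-false⁺ (ofʸ a) _ ¬a = ⊥-elim (¬a a)
  if-false⁺ (ofⁿ _) h _  = h

  if-true⁻ : ∀ {β b} → Reflects A β → (if β then true else b) ≡ true → A ⊎ b ≡ true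
  if-true⁻ (ofʸ a) _ = inj₁ a
  if-true⁻ (ofⁿ _) h = inj₂ h

  if-true⁺ : ∀ {β b} → Reflects A β → A ⊎ b ≡ true → (if β then true else b) ≡ true
  if-true⁺ (ofʸ _)  _        = refl
  if-true⁺ (ofⁿ ¬a) (inj₁ a) = ⊥-elim (¬a a)
  if-true⁺ (ofⁿ _)  (inj₂ h) = h

-- A record wrapper, so that the edge set can be inferred from an edge.
record Edge (F : EdgeSet n) (x y : Fin n) : Set where
  constructor edge
  field adjacent : Adj F x y
open Edge public

-- exchange F a b c d x y unfolds to  if sameEdge x y c d then true else delete F a b x y.
delete : EdgeSet n → Fin n → Fin n → EdgeSet n
delete F a b x y = if sameEdge x y a b then false else F x y

delete-edge⁻ : Edge (delete F a b) x y → Edge F x y × ¬ SameEdge x y a b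
delete-edge⁻ {a = a} {b} {x} {y} (edge h) = Product.map₁ edge (if-false⁻ (sameEdge-reflects x y a b) h)

delete-edge⁺ : Edge F x y → ¬ SameEdge x y a b → Edge (delete F a b) x y
delete-edge⁺ {x = x} {y} {a} {b} (edge h) ¬s = edge (if-false⁺ (sameEdge-reflects x y a b) h ¬s)

delete-swap : Edge (delete F a b) x y → Edge (delete F b a) x y
delete-swap e = let (e′ , ¬s) = delete-edge⁻ e in delete-edge⁺ e′ (¬s ∘ SameEdge-swap)

exchange-edge⁻ : Edge (exchange F a b c d) x y → SameEdge x y c d ⊎ Edge (delete F a b) x y
exchange-edge⁻ {c = c} {d} {x} {y} (edge h) = Sum.map₂ edge (if-true⁻ (sameEdge-reflects x y c d) h)

exchange-edge⁺ : SameEdge x y c d ⊎ Edge (delete F a b) x y → Edge (exchange F a b c d) x y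
exchange-edge⁺ {x = x} {y} {c} {d} s = edge (if-true⁺ (sameEdge-reflects x y c d) (Sum.map₂ adjacent s))

module _ (es : IsEdgeSet F) where

  Edge-sym : Edge F x y → Edge F y x
  Edge-sym {x} {y} (edge h) = edge (trans (proj₁ es y x) h)

  Edge-irrefl : ¬ Edge F x x
  Edge-irrefl {x} (edge h) with () ← trans (sym (proj₂ es x)) h

  delete-sym : Edge (delete F a b) x y → Edge (delete F a b) y x
  delete-sym e = let (e′ , ¬s) = delete-edge⁻ e in delete-edge⁺ (Edge-sym e′) (¬s ∘ SameEdge-sym)

isEdgeSet : (∀ {x y} → Edge F x y → Edge F y x) → (∀ {x} → ¬ Edge F x x) → IsEdgeSet F
isEdgeSet sym′ irrefl =
  (λ x y → ⇔→≡ (mk⇔ (adjacent ∘ sym′ ∘ edge) (adjacent ∘ sym′ ∘ edge))) ,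
  (λ x → ¬-not (irrefl ∘ edge))

module _ {A : Set} {R : Rel A 0ℓ} where

  NonBacktracking : ∀ {x y} → Star R x y → Set
  NonBacktracking ε                        = Unit
  NonBacktracking (_ ◅ ε)                  = Unit
  NonBacktracking {x} (_ ◅ _◅_ {j = z} r w) = x ≢ z × NonBacktracking (r ◅ w)

  NonBacktracking-tail : ∀ {x y z} (r : R x y) (w : Star R y z) →
                         NonBacktracking (r ◅ w) → NonBacktracking w
  NonBacktracking-tail r ε       _        = tt
  NonBacktracking-tail r (_ ◅ _) (_ , nb) = nb

  pruneBacktracks : DecidableEquality A → ∀ {x y} → Star R x y → Σ (Star R x y) NonBacktracking
  pruneBacktracks _≟_ ε = ε , tt
  pruneBacktracks _≟_ {x} (r ◅ w) with pruneBacktracks _≟_ w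
  ... | ε , _ = r ◅ ε , tt
  ... | _◅_ {j = z} r′ w′ , nb with z ≟ x
  ...   | yes refl = w′ , NonBacktracking-tail r′ w′ nb
  ...   | no z≢x   = r ◅ r′ ◅ w′ , z≢x ∘ sym , nb

  verticesAfterStart : ∀ {x y} → Star R x y → List A
  verticesAfterStart ε                 = []
  verticesAfterStart (_◅_ {j = z} _ w) = z ∷ verticesAfterStart w

  vertices : ∀ {x y} → Star R x y → List A
  vertices {x} w = x ∷ verticesAfterStart w

  All-last : ∀ {P : A → Set} {x y} (w : Star R x y) → All P (vertices w) → P y
  All-last ε       (p ∷ []) = p
  All-last (_ ◅ w) (_ ∷ ps) = All-last w ps

  lastOf : A → List A → A
  lastOf x []       = x
  lastOf _ (y ∷ ys) = lastOf y ys

  record SimplePath (x y : A) : Set where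
    field
      hops   : List A
      linked : Linked R (x ∷ hops)
      unique : Unique (x ∷ hops)
      ends   : lastOf x hops ≡ y

  dropUntil : ∀ {v x y} (p : SimplePath x y) → Any (v ≡_) (x ∷ SimplePath.hops p) → SimplePath v y
  dropUntil p (here refl) = p
  dropUntil record { hops = _ ∷ _ ; linked = linked ; unique = _ ∷ unique ; ends = ends } (there v∈p) =
    dropUntil record { linked = Linked.tail linked ; unique = unique ; ends = ends } v∈p

  shorten : DecidableEquality A → ∀ {x y} → Star R x y → SimplePath x y
  shorten _≟_ ε = record { hops = [] ; linked = [-] ; unique = [] ∷ [] ; ends = refl }
  shorten _≟_ {x} (_◅_ {j = z} r w) with shorten _≟_ w
  ... | p with any? (x ≟_) (z ∷ SimplePath.hops p)
  ...   | yes x∈p = dropUntil p x∈p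
  ...   | no  x∉p = record
    { hops   = z ∷ SimplePath.hops p
    ; linked = r ∷ SimplePath.linked p
    ; unique = ¬Any⇒All¬ _ x∉p ∷ SimplePath.unique p
    ; ends   = SimplePath.ends p
    }

  Linked-∷ʳ⁺ : ∀ {x xs y} → Linked R (x ∷ xs) → R (lastOf x xs) y → Linked R ((x ∷ xs) ∷ʳ y)
  Linked-∷ʳ⁺ {xs = []}    [-]      r = r ∷ [-]
  Linked-∷ʳ⁺ {xs = _ ∷ _} (r′ ∷ l) r = r′ ∷ Linked-∷ʳ⁺ l r

  firstStop : {S : Rel A 0ℓ} {P : A → Set} → (∀ {u v} → S u v → P u ⊎ R u v) →
              ∀ {x y} → Star S x y → Star R x y ⊎ ∃ λ u → P u × Star R x u
  firstStop classify ε = inj₁ ε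
  firstStop classify {x} (s ◅ w) with classify s
  ... | inj₁ Px = inj₂ (x , Px , ε)
  ... | inj₂ r  = Sum.map (r ◅_) (Product.map₂ (Product.map₂ (r ◅_))) (firstStop classify w)

_⊢_⇝_ : EdgeSet n → Fin n → Fin n → Set
F ⊢ x ⇝ y = Star (Edge F) x y

-- A simple a–b path avoiding ab is neither trivial nor ab itself, so together with ab it is a cycle.
acyclic⇒bridge : IsEdgeSet F → Acyclic F → Edge F a b → ¬ (delete F a b ⊢ a ⇝ b)
acyclic⇒bridge {a = a} es acyclic ab w with shorten _≟_ w
... | record { hops = [] ; ends = refl } = Edge-irrefl es ab
... | record { hops = _ ∷ [] ; linked = e ∷ [-] ; ends = refl } = proj₂ (delete-edge⁻ e) (inj₁ (refl , refl))
... | record { hops = p ∷ q ∷ qs ; linked = linked ; unique = unique ; ends = ends } =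
  acyclic (a , p ∷ q ∷ qs , s≤s (s≤s z≤n) , unique ,
           Linked-∷ʳ⁺ (Linked.map (adjacent ∘ proj₁ ∘ delete-edge⁻) linked)
                      (adjacent (Edge-sym es (subst (Edge _ a) (sym ends) ab))))

-- Deleting the first edge of a cycle leaves the rest of the cycle as a walk between its ends.
bridges⇒acyclic : (∀ {x y} → Edge F x y → ¬ (delete F x y ⊢ y ⇝ x)) → Acyclic F
bridges⇒acyclic bridge (_ , []         , ()       , _)
bridges⇒acyclic bridge (_ , _ ∷ []     , s≤s ()   , _)
bridges⇒acyclic {F = F} bridge (v , w₁ ∷ w₂ ∷ ws , _ , (v≢ ∷ w₁≢ ∷ _) , (vw₁ ∷ w₁w₂ ∷ rest)) =
  bridge (edge vw₁) (delete-edge⁺ (edge w₁w₂) first ◅ around w₂ ws rest (All.zip (All.tail v≢ , w₁≢)))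
  where
  first : ¬ SameEdge w₁ w₂ v w₁
  first (inj₁ (w₁≡v , _)) = All.head v≢ (sym w₁≡v)
  first (inj₂ (_ , w₂≡v)) = All.head (All.tail v≢) (sym w₂≡v)

  avoid : ∀ {u u′} → v ≢ u × w₁ ≢ u → ¬ SameEdge u u′ v w₁
  avoid (v≢u , _)  (inj₁ (u≡v , _))  = v≢u (sym u≡v)
  avoid (_ , w₁≢u) (inj₂ (u≡w₁ , _)) = w₁≢u (sym u≡w₁)

  around : ∀ u us → Linked (Adj F) (u ∷ us ∷ʳ v) → All (λ u → v ≢ u × w₁ ≢ u) (u ∷ us) →
         delete F v w₁ ⊢ u ⇝ v
  around u []        (uv ∷ [-]) (good ∷ [])    = delete-edge⁺ (edge uv) (avoid good) ◅ ε
  around u (u′ ∷ us) (uu′ ∷ l)  (good ∷ goods) = delete-edge⁺ (edge uu′) (avoid good) ◅ around u′ us l goods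

InducedEdge : EdgeSet n → Subset n → Rel (Fin n) 0ℓ
InducedEdge F M u v = Edge F u v × u ∈ M × v ∈ M

OuterEdge : EdgeSet n → Subset n → Rel (Fin n) 0ℓ
OuterEdge F U u v = Edge F u v × ¬ (u ∈ U × v ∈ U)

Walk-start : {M : Subset n} → Walk F M x y → x ∈ M
Walk-start (stay m)     = m
Walk-start (step m _ _) = m

Walk⇒Star : {M : Subset n} → Walk F M x y → Star (InducedEdge F M) x y
Walk⇒Star (stay _)     = ε
Walk⇒Star (step m e w) = (edge e , m , Walk-start w) ◅ Walk⇒Star w

Star⇒Walk : {M : Subset n} (w : F ⊢ x ⇝ y) → All (_∈ M) (vertices w) → Walk F M x y
Star⇒Walk ε              (m ∷ []) = stay m
Star⇒Walk (edge e ◅ w) (m ∷ ms) = step m e (Star⇒Walk w ms)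

connected : IsSpanningTree F → ∀ x y → F ⊢ x ⇝ y
connected (_ , conn , _) x y = Star.map proj₁ (Walk⇒Star (conn x y ∈⊤ ∈⊤))

treePath : IsSpanningTree F → ∀ x y → Σ (F ⊢ x ⇝ y) NonBacktracking
treePath T x y = pruneBacktracks _≟_ (connected T x y)

spanning : (∀ x y → F ⊢ x ⇝ y) → ConnectedOn F ⊤
spanning conn x y _ _ = Star⇒Walk (conn x y) (All.tabulate λ _ → ∈⊤)

either-end : (∀ x y → F ⊢ x ⇝ y) → ∀ a b x → delete F a b ⊢ x ⇝ a ⊎ delete F a b ⊢ x ⇝ b
either-end {F = F} conn a b x = go (conn x a)
  where
  go : ∀ {x} → F ⊢ x ⇝ a → delete F a b ⊢ x ⇝ a ⊎ delete F a b ⊢ x ⇝ b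
  go ε = inj₁ ε
  go {x} (_◅_ {j = z} e w) with sameEdge? x z a b
  ... | yes (inj₁ (refl , _)) = inj₁ ε
  ... | yes (inj₂ (refl , _)) = inj₂ ε
  ... | no ¬s = Sum.map (delete-edge⁺ e ¬s ◅_) (delete-edge⁺ e ¬s ◅_) (go w)

module _ (T : IsSpanningTree F) where

  private
    es = proj₁ T

  sides-disjoint : Edge F a b → delete F a b ⊢ x ⇝ a → ¬ (delete F a b ⊢ x ⇝ b)
  sides-disjoint ab p q = acyclic⇒bridge es (proj₂ (proj₂ T)) ab (reverse (delete-sym es) p ◅◅ q)

  farSide-⊆ : Edge F y z → x ≢ z → delete F y z ⊢ w ⇝ z → delete F x y ⊢ w ⇝ y
  farSide-⊆ {y = y} {z = z} {x = x} yz x≢z ε = delete-edge⁺ (Edge-sym es yz) zy≉xy ◅ ε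
    where
    zy≉xy : ¬ SameEdge z y x y
    zy≉xy (inj₁ (z≡x , _)) = x≢z (sym z≡x)
    zy≉xy (inj₂ (z≡y , _)) = Edge-irrefl es (subst (Edge F y) z≡y yz)
  farSide-⊆ {y = y} {x = x} {w = w} yz x≢z (_◅_ {j = w′} e rest) with sameEdge? w w′ x y
  ... | no ¬s                   = delete-edge⁺ (proj₁ (delete-edge⁻ e)) ¬s ◅ farSide-⊆ yz x≢z rest
  ... | yes (inj₂ (refl , _))    = ε
  ... | yes (inj₁ (refl , refl)) = ⊥-elim (sides-disjoint yz ε rest)

  nearSide-⊆ : Edge F x y → x ≢ z → delete F x y ⊢ w ⇝ x → delete F y z ⊢ w ⇝ y
  nearSide-⊆ xy x≢z = Star.map delete-swap ∘ farSide-⊆ (Edge-sym es xy) (x≢z ∘ sym) ∘ Star.map delete-swap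

  module _ {R : Rel (Fin _) 0ℓ} (R⇒F : R ⇒ Edge F) where

    nonBacktracking-farSide : (r : R x y) (w : Star R y z) → NonBacktracking (r ◅ w) →
                              All (λ v → delete F x y ⊢ v ⇝ y) (vertices w)
    nonBacktracking-farSide r ε        _          = ε ∷ []
    nonBacktracking-farSide r (r′ ◅ w) (x≢ , nb) =
      ε ∷ All.map (farSide-⊆ (R⇒F r′) x≢) (nonBacktracking-farSide r′ w nb)

module _ (T : IsSpanningTree F) (ab : Edge F a b) (ca : delete F a b ⊢ c ⇝ a) (db : delete F a b ⊢ d ⇝ b) where

  private
    H = exchange F a b c d
    es = proj₁ T

    rev : delete F a b ⊢ x ⇝ y → delete F a b ⊢ y ⇝ x
    rev = reverse (delete-sym es)

    c≢d : c ≢ d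
    c≢d c≡d = sides-disjoint T ab ca (subst (λ v → delete F a b ⊢ v ⇝ b) (sym c≡d) db)

    H-sym : Edge H x y → Edge H y x
    H-sym = exchange-edge⁺ ∘ Sum.map SameEdge-sym (delete-sym es) ∘ exchange-edge⁻

    H-irrefl : ¬ Edge H x x
    H-irrefl e with exchange-edge⁻ e
    ... | inj₁ (inj₁ (x≡c , x≡d)) = c≢d (trans (sym x≡c) x≡d)
    ... | inj₁ (inj₂ (x≡d , x≡c)) = c≢d (trans (sym x≡c) x≡d)
    ... | inj₂ e′                 = Edge-irrefl es (proj₁ (delete-edge⁻ e′))

    H-isEdgeSet : IsEdgeSet H
    H-isEdgeSet = isEdgeSet H-sym H-irrefl

    embed : delete F a b ⊢ x ⇝ y → H ⊢ x ⇝ y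
    embed = Star.map (exchange-edge⁺ ∘ inj₂)

    ⇝a : ∀ x → H ⊢ x ⇝ a
    ⇝a x with either-end (connected T) a b x
    ... | inj₁ x⇝a = embed x⇝a
    ... | inj₂ x⇝b = embed (x⇝b ◅◅ rev db) ◅◅ exchange-edge⁺ (inj₁ (inj₂ (refl , refl))) ◅ embed ca

    delete-cd : SameEdge x y c d → Edge (delete H x y) u v → Edge (delete F a b) u v
    delete-cd xy≈cd e with delete-edge⁻ e
    ... | e′ , uv≉xy with exchange-edge⁻ e′
    ...   | inj₁ uv≈cd = ⊥-elim (uv≉xy (SameEdge-trans uv≈cd (SameEdge-comm xy≈cd)))
    ...   | inj₂ e″    = e″

    cd-bridge : SameEdge x y c d → ¬ (delete H x y ⊢ y ⇝ x)
    cd-bridge xy≈cd W with xy≈cd | Star.map (delete-cd xy≈cd) W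
    ... | inj₁ (refl , refl) | d⇝c = sides-disjoint T ab (d⇝c ◅◅ ca) db
    ... | inj₂ (refl , refl) | c⇝d = sides-disjoint T ab ca (c⇝d ◅◅ db)

    -- A walk y ⇝ x in H − xy must use cd: its pieces before the first and after the last use
    -- of cd join x and y to c or d inside F − ab − xy, which separates either x from y or a from b.
    old-bridge : Edge (delete F a b) x y → ¬ (delete H x y ⊢ y ⇝ x)
    old-bridge {x} {y} xy W =
      separate (firstStop classify W) (firstStop classify (reverse (delete-sym H-isEdgeSet) W))
      where
      Step : Rel (Fin _) 0ℓ
      Step u v = Edge (delete F a b) u v × ¬ SameEdge u v x y

      classify : Edge (delete H x y) u v → (u ≡ c ⊎ u ≡ d) ⊎ Step u v
      classify e with delete-edge⁻ e
      ... | e′ , uv≉xy with exchange-edge⁻ e′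
      ...   | inj₁ (inj₁ (u≡c , _)) = inj₁ (inj₁ u≡c)
      ...   | inj₁ (inj₂ (u≡d , _)) = inj₁ (inj₂ u≡d)
      ...   | inj₂ e″              = inj₂ (e″ , uv≉xy)

      xyF = proj₁ (delete-edge⁻ xy)

      ab⁻ : Star Step u v → delete F a b ⊢ u ⇝ v
      ab⁻ = Star.map proj₁

      xy⁻ : Star Step u v → delete F x y ⊢ u ⇝ v
      xy⁻ = Star.map λ (e , uv≉xy) → delete-edge⁺ (proj₁ (delete-edge⁻ e)) uv≉xy

      Reaches : Fin _ → Fin _ → Set
      Reaches s t = Star Step s t ⊎ ∃ λ u → (u ≡ c ⊎ u ≡ d) × Star Step s u

      separate : Reaches y x → Reaches x y → ⊥
      separate (inj₁ y⇝x) _ = sides-disjoint T xyF (xy⁻ y⇝x) ε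
      separate _ (inj₁ x⇝y) = sides-disjoint T xyF ε (xy⁻ x⇝y)
      separate (inj₂ (_ , inj₁ refl , y⇝c)) (inj₂ (_ , inj₁ refl , x⇝c)) =
        sides-disjoint T xyF (xy⁻ y⇝c ◅◅ reverse (delete-sym es) (xy⁻ x⇝c)) ε
      separate (inj₂ (_ , inj₂ refl , y⇝d)) (inj₂ (_ , inj₂ refl , x⇝d)) =
        sides-disjoint T xyF (xy⁻ y⇝d ◅◅ reverse (delete-sym es) (xy⁻ x⇝d)) ε
      separate (inj₂ (_ , inj₁ refl , y⇝c)) (inj₂ (_ , inj₂ refl , x⇝d)) =
        sides-disjoint T ab (rev (ab⁻ x⇝d) ◅◅ xy ◅ ab⁻ y⇝c ◅◅ ca) db
      separate (inj₂ (_ , inj₂ refl , y⇝d)) (inj₂ (_ , inj₁ refl , x⇝c)) =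
        sides-disjoint T ab ca (rev (ab⁻ x⇝c) ◅◅ xy ◅ ab⁻ y⇝d ◅◅ db)

  exchange-isSpanningTree : IsSpanningTree (exchange F a b c d)
  exchange-isSpanningTree =
    H-isEdgeSet ,
    spanning (λ x y → ⇝a x ◅◅ reverse H-sym (⇝a y)) ,
    bridges⇒acyclic λ xy → Sum.[ cd-bridge , old-bridge ] (exchange-edge⁻ xy)

module _ {F₁ F₂ : EdgeSet n} (T₁ : IsSpanningTree F₁) (T₂ : IsSpanningTree F₂)
         {R₁ R₂ : Rel (Fin n) 0ℓ} (R₁⇒F₁ : R₁ ⇒ Edge F₁) (R₂⇒F₂ : R₂ ⇒ Edge F₂) where

  SymmetricExchange : Set
  SymmetricExchange = Σ (Fin n) λ a → Σ (Fin n) λ b → Σ (Fin n) λ c → Σ (Fin n) λ d →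
    R₁ a b × R₂ c d × IsSpanningTree (exchange F₁ a b c d) × IsSpanningTree (exchange F₂ c d a b)

  private
    -- Invariant: r lies on p's side of F₁ − pp′ and p on r's side of F₂ − rr′.
    -- If r′ lies there too, advance along Q; if p′ lies on r's side, advance along P; otherwise
    -- both exchanges reconnect the two sides.  Neither walk can run out first, since a
    -- non-backtracking walk in a tree ends beyond its first edge.
    advance : ∀ {p p′ r r′ v} (e : R₁ p p′) (P : Star R₁ p′ v) → NonBacktracking (e ◅ P) →
              (f : R₂ r r′) (Q : Star R₂ r′ v) → NonBacktracking (f ◅ Q) →
              delete F₁ p p′ ⊢ r ⇝ p → delete F₂ r r′ ⊢ p ⇝ r → SymmetricExchange
    advance {p} {p′} {r} {r′} e P nbP f Q nbQ r⇝p p⇝r with either-end (connected T₁) p p′ r′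
    ... | inj₁ r′⇝p with Q
    ...   | ε = ⊥-elim (sides-disjoint T₁ (R₁⇒F₁ e) r′⇝p
                         (All-last P (nonBacktracking-farSide T₁ R₁⇒F₁ e P nbP)))
    ...   | f′ ◅ Q′ = advance e P nbP f′ Q′ (NonBacktracking-tail f (f′ ◅ Q′) nbQ) r′⇝p
                        (nearSide-⊆ T₂ (R₂⇒F₂ f) (proj₁ nbQ) p⇝r)
    advance {p} {p′} {r} {r′} e P nbP f Q nbQ r⇝p p⇝r | inj₂ r′⇝p′ with either-end (connected T₂) r r′ p′
    ... | inj₂ p′⇝r′ = p , p′ , r , r′ , e , f ,
                       exchange-isSpanningTree T₁ (R₁⇒F₁ e) r⇝p r′⇝p′ ,
                       exchange-isSpanningTree T₂ (R₂⇒F₂ f) p⇝r p′⇝r′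
    ... | inj₁ p′⇝r with P
    ...   | ε = ⊥-elim (sides-disjoint T₂ (R₂⇒F₂ f) p′⇝r
                         (All-last Q (nonBacktracking-farSide T₂ R₂⇒F₂ f Q nbQ)))
    ...   | e′ ◅ P′ = advance e′ P′ (NonBacktracking-tail e (e′ ◅ P′) nbP) f Q nbQ
                        (nearSide-⊆ T₁ (R₁⇒F₁ e) (proj₁ nbP) r⇝p) p′⇝r

  symmetricExchange : ∀ {u p v} (e : R₁ u p) (P : Star R₁ p v) → NonBacktracking (e ◅ P) →
                      (Q : Star R₂ u v) → NonBacktracking Q → SymmetricExchange
  symmetricExchange e P nbP ε _ =
    ⊥-elim (sides-disjoint T₁ (R₁⇒F₁ e) ε (All-last P (nonBacktracking-farSide T₁ R₁⇒F₁ e P nbP)))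
  symmetricExchange e P nbP (f ◅ Q) nbQ = advance e P nbP f Q nbQ ε ε

module _ (T : IsSpanningTree F) {D : Fin n → Set} (D? : U.Decidable D) (one : AtMostOneCrossing F D) where

  -- The first edge of the walk is the only edge leaving D, and the walk stays beyond it.
  trapped : (e : Edge F x y) → ¬ D x → D y → (w : F ⊢ y ⇝ z) → NonBacktracking (e ◅ w) → D z
  trapped {x} {y} {z} e ¬Dx Dy w nb = go w (nonBacktracking-farSide T id e w nb) Dy
    where
    go : ∀ {u} (w : F ⊢ u ⇝ z) → All (λ v → delete F x y ⊢ v ⇝ y) (vertices w) → D u → D z
    go ε _ Du = Du
    go (_◅_ {j = u′} e′ w) (_ ∷ beyond) Du with D? u′
    ... | yes Du′ = go w beyond Du′
    ... | no ¬Du′ with one _ _ _ _ (adjacent (Edge-sym (proj₁ T) e)) Dy ¬Dx (adjacent e′) Du ¬Du′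
    ...   | refl , refl = ⊥-elim (sides-disjoint T e ε (All.head beyond))

disconnected⇒leaves : {M : Subset n} → ¬ ConnectedOn F M → (W : ∀ x y → F ⊢ x ⇝ y) →
                      Σ (Fin n) λ u → Σ (Fin n) λ v → u ∈ M × v ∈ M × ¬ All (_∈ M) (vertices (W u v))
disconnected⇒leaves {M = M} disconnected W
  with Fin.any? (λ u → Fin.any? λ v → (u ∈? M) ×-dec (v ∈? M) ×-dec ¬? (All.all? (_∈? M) (vertices (W u v))))
... | yes (u , v , leaves) = u , v , leaves
... | no none = ⊥-elim (disconnected λ u v u∈M v∈M →
    Star⇒Walk (W u v) (decidable-stable (All.all? (_∈? M) _) λ ¬all → none (u , v , u∈M , v∈M , ¬all)))

module _ {Sj : EdgeSet n} (Tj : IsSpanningTree Sj) (U M : Subset n) (oneCrossing : AtMostOneCrossing Sj (InDiff U M)) where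

  InDiff? : U.Decidable (InDiff U M)
  InDiff? v = (v ∈? U) ×-dec ¬? (v ∈? M)

  Excursion : Fin n → Fin n → Set
  Excursion p z = Σ (OuterEdge Sj U p z) λ e → Σ (Fin n) λ v → v ∈ M ×
                  Σ (Star (OuterEdge Sj U) z v) λ P → NonBacktracking (e ◅ P)

  -- Having stepped out of M from outside U ∖ M, the walk cannot enter U ∖ M (it would be
  -- trapped there), so it stays outside U until it returns to M.
  excursion : (e : Edge Sj x z) (w : Sj ⊢ z ⇝ y) → NonBacktracking (e ◅ w) →
              ¬ InDiff U M x → z ∉ M → y ∈ M → Excursion x z
  excursion e ε _ _ z∉M y∈M = ⊥-elim (z∉M y∈M)
  excursion {z = z} e (_◅_ {j = z′} e′ w) nb x∉D z∉M y∈M with z ∈? U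
  ... | yes z∈U = ⊥-elim (proj₂ (trapped Tj InDiff? oneCrossing e x∉D (z∈U , z∉M) (e′ ◅ w) nb) y∈M)
  ... | no z∉U with z′ ∈? M
  ...   | yes z′∈M = (e , z∉U ∘ proj₂) , z′ , z′∈M , (e′ , z∉U ∘ proj₁) ◅ ε , proj₁ nb , tt
  ...   | no z′∉M with excursion e′ w (proj₂ nb) (z∉U ∘ proj₁) z′∉M y∈M
  ...     | e″ , v , v∈M , P , nbP = (e , z∉U ∘ proj₂) , v , v∈M , e″ ◅ P , proj₁ nb , nbP

  firstExcursion : (W : Sj ⊢ x ⇝ y) → NonBacktracking W → x ∈ M → y ∈ M → ¬ All (_∈ M) (vertices W) →
          Σ (Fin n) λ u → Σ (Fin n) λ z → u ∈ M × Excursion u z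
  firstExcursion ε _ x∈M _ ¬all = ⊥-elim (¬all (x∈M ∷ []))
  firstExcursion {x} (_◅_ {j = x₁} e w) nb x∈M y∈M ¬all with x₁ ∈? M
  ... | yes x₁∈M = firstExcursion w (NonBacktracking-tail e w nb) x₁∈M y∈M (¬all ∘ (x∈M ∷_))
  ... | no x₁∉M  = x , x₁ , x∈M , excursion e w nb (λ x∈D → proj₂ x∈D x∈M) x₁∉M y∈M

lemma8 : (n : ℕ) (s t : Fin n) → s ≢ t →
    (U M : Subset n) → s ∈ U → t ∉ U → M ⊆ U →
    (Sj Sk : EdgeSet n) → IsSpanningTree Sj → IsSpanningTree Sk →
    ¬ ConnectedOn Sj M → ConnectedOn Sk M →
    AtMostOneCrossing Sj (InDiff U M) →
    Σ (Fin n) λ a → Σ (Fin n) λ b → Σ (Fin n) λ c → Σ (Fin n) λ d →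
      Adj Sj a b × Adj Sk c d ×
      IsSpanningTree (exchange Sj a b c d) ×
      IsSpanningTree (exchange Sk c d a b) ×
      ¬ (a ∈ U × b ∈ U) × (c ∈ M × d ∈ M)
lemma8 n s t _ U M _ _ _ Sj Sk Tj Tk Sj-disconnected Sk-connected oneCrossing
  with u₀ , v₀ , u₀∈M , v₀∈M , leaves ←
         disconnected⇒leaves Sj-disconnected (λ x y → proj₁ (treePath Tj x y))
  with u , _ , u∈M , e , v , v∈M , P , nbP ←
         firstExcursion Tj U M oneCrossing (proj₁ (treePath Tj u₀ v₀)) (proj₂ (treePath Tj u₀ v₀))
                        u₀∈M v₀∈M leaves
  with Q , nbQ ← pruneBacktracks _≟_ (Walk⇒Star (Sk-connected u v u∈M v∈M))
  with a , b , c , d , (ab , ab⊄U) , (cd , c∈M , d∈M) , Tj′ , Tk′ ←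
         symmetricExchange Tj Tk proj₁ proj₁ e P nbP Q nbQ
  = a , b , c , d , adjacent ab , adjacent cd , Tj′ , Tk′ , ab⊄U , c∈M , d∈M
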